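{- A digraph $H$ admits a conservative majority polymorphism if and only if $H$ has no permutable triple.
   Context: A digraph $H$ is a finite set $V(H)$ with a binary relation $E(H)$ (arcs). A ternary polymorphism of $H$ is a map $\mu:V(H)^3\to V(H)$ such that whenever $u_1v_1,u_2v_2,u_3v_3\in E(H)$, also $\mu(u_1,u_2,u_3)\mu(v_1,v_2,v_3)\in E(H)$. It is conservative if $\mu(a,b,c)\in\{a,b,c\}$ always, and a majority function if $\mu(a,a,b)=\mu(a,b,a)=\mu(b,a,a)=a$ for all $a,b$. A walk in $H$ is a sequence $x_0,\dots,x_n$ of vertices together with, for each $i$, a designation of step $i$ as forward (requiring $x_ix_{i+1}\in E(H)$) or backward (requiring $x_{i+1}x_i\in E(H)$). Two walks $P=x_0,\dots,x_n$ and $Q=y_0,\dots,y_n$ are congruent if for every $i$ step $i$ of $P$ is forward iff step $i$ of $Q$ is forward. For congruent $P,Q$, $P$ avoids $Q$ if there is no $i$ with step $i$ forward and $x_iy_{i+1}\in E(H)$, and no $i$ with step $i$ backward and $y_{i+1}x_i\in E(H)$. A permutable triple consists of three distinct vertices $u,v,w$ together with six vertices $s(u),b(u),s(v),b(v),s(w),b(w)$ such that for each $x\in\{u,v,w\}$, with $y,z$ the other two, there exist a walk $P(x,s(x))$ from $x$ to $s(x)$ and walks $P(y,b(x))$ from $y$ to $b(x)$ and $P(z,b(x))$ from $z$ to $b(x)$, both congruent to $P(x,s(x))$, such that $P(x,s(x))$ avoids both $P(y,b(x))$ and $P(z,b(x))$. -}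

module Defs where

open import Data.Nat using (ℕ)
open import Data.Fin using (Fin)
open import Data.Bool using (Bool; true)
open import Data.List using (List; []; _∷_)
open import Data.Product using (Σ; ∃; _×_)
open import Data.Sum using (_⊎_)
open import Data.Unit using (⊤)
open import Relation.Nullary using (¬_)
open import Relation.Binary.PropositionalEquality using (_≡_; _≢_)

-- A (finite) digraph: vertex set Fin n, arc relation given by a Boolean adjacency
-- function (every relation on a finite set is decidable).
record Digraph : Set where
  field
    n   : ℕ
    adj : Fin n → Fin n → Bool

module _ (H : Digraph) where
  open Digraph H

  V : Set
  V = Fin n

  Arc : V → V → Set
  Arc u v = adj u v ≡ true

  IsPolymorphism : (V → V → V → V) → Set
  IsPolymorphism μ = ∀ {u₁ v₁ u₂ v₂ u₃ v₃} →
    Arc u₁ v₁ → Arc u₂ v₂ → Arc u₃ v₃ → Arc (μ u₁ u₂ u₃) (μ v₁ v₂ v₃)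

  IsConservative : (V → V → V → V) → Set
  IsConservative μ = ∀ a b c → (μ a b c ≡ a) ⊎ (μ a b c ≡ b) ⊎ (μ a b c ≡ c)

  IsMajority : (V → V → V → V) → Set
  IsMajority μ = ∀ a b → (μ a a b ≡ a) × (μ a b a ≡ a) × (μ b a a ≡ a)

  HasConservativeMajorityPolymorphism : Set
  HasConservativeMajorityPolymorphism =
    Σ (V → V → V → V) λ μ → IsPolymorphism μ × IsConservative μ × IsMajority μ

data Dir : Set where
  forward backward : Dir

module _ (H : Digraph) where
  open Digraph H

  -- Walk H ds x y : a walk from x to y whose sequence of step directions is ds.
  -- Two walks are congruent iff they have the same direction list ds.
  data Walk : List Dir → V H → V H → Set where
    []   : ∀ {x} → Walk [] x x
    fwd  : ∀ {ds} {x y z} → Arc H x y → Walk ds y z → Walk (forward ∷ ds) x z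
    bwd  : ∀ {ds} {x y z} → Arc H y x → Walk ds y z → Walk (backward ∷ ds) x z

  Avoids : ∀ {ds x x' y y'} → Walk ds x x' → Walk ds y y' → Set
  Avoids [] [] = ⊤
  Avoids (fwd {x = x} _ p) (fwd {y = y₁} _ q) = ¬ Arc H x y₁ × Avoids p q
  Avoids (bwd {x = x} _ p) (bwd {y = y₁} _ q) = ¬ Arc H y₁ x × Avoids p q

  PermCondition : (x y z sx bx : V H) → Set
  PermCondition x y z sx bx =
    Σ (List Dir) λ ds →
    Σ (Walk ds x sx) λ P →
    Σ (Walk ds y bx) λ Q →
    Σ (Walk ds z bx) λ R →
    Avoids P Q × Avoids P R

  record PermutableTriple : Set where
    field
      u v w : V H
      u≢v : u ≢ v
      u≢w : u ≢ w
      v≢w : v ≢ w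
      s b : V H → V H
      cond-u : PermCondition u v w (s u) (b u)
      cond-v : PermCondition v u w (s v) (b v)
      cond-w : PermCondition w u v (s w) (b w)

module Submission where

-- Central notion: a triple (x, y, z) of vertices is BLOCKED when there are congruent walks
-- P, Q, R starting at x, y, z such that P avoids Q and R and Q, R end at a common vertex;
-- these are exactly the walks demanded of x in a permutable triple.  Blocked triples are
-- the triples from which the digraph of "triple moves" reaches the diagonal y = z.
--
-- (⇒) A conservative polymorphism g with g b a a ≡ a never selects the first coordinate of
--     a blocked triple: by induction along the walks, g cannot select the current vertex
--     of P, since g selects Q or R one step later and P avoids both; at the end Q = R
--     and g selects their common vertex by majority.  Applied to μ and two permutations of its arguments,
--     this rules out each of u, v, w as the value μ u v w on a permutable triple.
-- (⇐) Blocking is decidable (reachability in a finite transition system, decided by a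
--     bounded search justified by loop erasure), so μ can select the first coordinate of
--     (a, b, c) that is not blocked.  Without permutable triples such a coordinate exists
--     unless a = b = c.  That μ preserves arcs rests on one exchange lemma: if u picks
--     coordinate i, v picks j ≠ i and there is no arc u_i → v_j, then i and j are both
--     unblocked in both triples, contradicting that each triple picked the earliest one.

open import Defs
open import Function.Base using (id; _∘_)
open import Function.Bundles using (_⇔_; mk⇔)
open import Data.Nat.Base using (ℕ; zero; suc; _≤_; z≤n; s≤s)
open import Data.Nat.Properties using (≤-trans; n≤1+n; module ≤-Reasoning)
open import Data.Bool.Base using (true)
import Data.Bool.Properties as Bool
open import Data.Fin.Properties using (_≟_)
open import Data.List.Base using (List; []; _∷_; length; allFin; cartesianProduct)
open import Data.List.Properties using (length-removeAt′)
open import Data.List.Membership.Propositional using (_∈_; lose)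
open import Data.List.Membership.Propositional.Properties using (∈-allFin; ∈-cartesianProduct⁺)
open import Data.List.Relation.Unary.Any using (here; there; index; _─_; any?; satisfied)
import Data.List.Relation.Unary.All as All
open import Data.List.Relation.Unary.All.Properties using (¬Any⇒All¬)
open import Data.List.Relation.Unary.Unique.Propositional using (Unique)
open import Data.List.Relation.Unary.AllPairs using ([]; _∷_)
open import Data.Product.Base using (Σ; ∃; ∃₂; _×_; _,_; proj₁; proj₂)
open import Data.Product.Properties using (≡-dec)
open import Data.Sum.Base using (_⊎_; inj₁; inj₂; [_,_]; fromInj₁)
open import Data.Empty using (⊥; ⊥-elim)
open import Data.Unit.Base using (tt)
open import Relation.Nullary using (¬_; Dec; yes; no; contradiction)
open import Relation.Nullary.Decidable using (_×-dec_; _⊎-dec_; ¬?; map′)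
open import Relation.Binary.Definitions using (DecidableEquality)
open import Relation.Binary.PropositionalEquality using (_≡_; _≢_; refl; sym; subst; subst₂; cong)

∈-─ : ∀ {A : Set} {x y : A} {ys : List A} (x∈ys : x ∈ ys) →
      y ∈ ys → y ≢ x → y ∈ (ys ─ x∈ys)
∈-─ (here refl) (here refl) y≢x = contradiction refl y≢x
∈-─ (here refl) (there y∈ys) _ = y∈ys
∈-─ (there _) (here refl) _ = here refl
∈-─ (there x∈ys) (there y∈ys) y≢x = there (∈-─ x∈ys y∈ys y≢x)

-- Pigeonhole for lists: a duplicate-free list all of whose members occur in ys is no
-- longer than ys.  This bounds the length of loop-free paths in a finite system.
unique-length-≤ : ∀ {A : Set} {xs ys : List A} →
                  Unique xs → (∀ {x} → x ∈ xs → x ∈ ys) → length xs ≤ length ys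
unique-length-≤ {xs = []} _ _ = z≤n
unique-length-≤ {xs = x ∷ xs} {ys} (x∉xs ∷ unique) xs⊆ys = begin
  suc (length xs)          ≤⟨ s≤s (unique-length-≤ unique xs⊆ys─x) ⟩
  suc (length (ys ─ x∈ys)) ≡⟨ sym (length-removeAt′ ys (index x∈ys)) ⟩
  length ys                ∎
  where
  open ≤-Reasoning
  x∈ys : x ∈ ys
  x∈ys = xs⊆ys (here refl)
  xs⊆ys─x : ∀ {y} → y ∈ xs → y ∈ (ys ─ x∈ys)
  xs⊆ys─x y∈xs = ∈-─ x∈ys (xs⊆ys (there y∈xs)) (λ y≡x → All.lookup x∉xs y∈xs (sym y≡x))

module Reachability {S : Set} (Step : S → S → Set) (Goal : S → Set) where

  data Reach : S → Set where
    done : ∀ {s} → Goal s → Reach s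
    next : ∀ {s t} → Step s t → Reach t → Reach s

  map-Reach : (f : S → S) → (∀ {s t} → Step s t → Step (f s) (f t)) →
              (∀ {s} → Goal s → Goal (f s)) → ∀ {s} → Reach s → Reach (f s)
  map-Reach _ _ goal (done g) = done (goal g)
  map-Reach f step goal (next st r) = next (step st) (map-Reach f step goal r)

  steps : ∀ {s} → Reach s → ℕ
  steps (done _) = zero
  steps (next _ r) = suc (steps r)

  visits : ∀ {s} → Reach s → List S
  visits {s} (done _) = s ∷ []
  visits {s} (next _ r) = s ∷ visits r

  length-visits : ∀ {s} (r : Reach s) → length (visits r) ≡ suc (steps r)
  length-visits (done _) = refl
  length-visits (next _ r) = cong suc (length-visits r)

  -- Reachability within k steps; unlike Reach it is decidable by recursion on k.
  Within : ℕ → S → Set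
  Within zero s = Goal s
  Within (suc k) s = Goal s ⊎ ∃ λ t → Step s t × Within k t

  within⇒reach : ∀ k {s} → Within k s → Reach s
  within⇒reach zero g = done g
  within⇒reach (suc k) (inj₁ g) = done g
  within⇒reach (suc k) (inj₂ (_ , st , w)) = next st (within⇒reach k w)

  reach⇒within : ∀ {k s} (r : Reach s) → steps r ≤ k → Within k s
  reach⇒within {zero} (done g) _ = g
  reach⇒within {suc k} (done g) _ = inj₁ g
  reach⇒within {suc k} (next st r) (s≤s r≤k) = inj₂ (_ , st , reach⇒within r r≤k)

  suffix-from : ∀ {s t} (r : Reach s) → t ∈ visits r →
                Σ (Reach t) λ q → Unique (visits r) → Unique (visits q)
  suffix-from (done g) (here refl) = done g , id
  suffix-from (done _) (there ())
  suffix-from (next st r) (here refl) = next st r , id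
  suffix-from (next _ r) (there t∈r) =
    let (q , keeps-unique) = suffix-from r t∈r in q , λ { (_ ∷ unique) → keeps-unique unique }

  -- Decidability of Reach when S is finite and steps and goals are decidable: a shortest
  -- path visits each state at most once, so searching up to |S| steps suffices.
  module Decide (_≟S_ : DecidableEquality S) (states : List S) (complete : ∀ s → s ∈ states)
                (step? : ∀ s t → Dec (Step s t)) (goal? : ∀ s → Dec (Goal s)) where

    within? : ∀ k s → Dec (Within k s)
    within? zero s = goal? s
    within? (suc k) s =
      goal? s ⊎-dec map′ satisfied (λ (t , p) → lose (complete t) p)
                         (any? (λ t → step? s t ×-dec within? k t) states)

    erase-loops : ∀ {s} → Reach s → Σ (Reach s) (Unique ∘ visits)
    erase-loops (done g) = done g , All.[] ∷ []
    erase-loops {s} (next st r) with erase-loops r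
    ... | r' , unique with any? (s ≟S_) (visits r')
    ...   | yes s∈r' = let (q , keeps-unique) = suffix-from r' s∈r' in q , keeps-unique unique
    ...   | no s∉r' = next st r' , ¬Any⇒All¬ _ s∉r' ∷ unique

    loop-free-bound : ∀ {s} (r : Reach s) → Unique (visits r) → steps r ≤ length states
    loop-free-bound r unique =
      ≤-trans (n≤1+n _) (subst (_≤ length states) (length-visits r)
                               (unique-length-≤ unique (λ {s} _ → complete s)))

    reach? : ∀ s → Dec (Reach s)
    reach? s = map′ (within⇒reach (length states))
                    (λ r → let (q , unique) = erase-loops r
                           in reach⇒within q (loop-free-bound q unique))
                    (within? (length states) s)

module TripleGraph (H : Digraph) where

  Triple : Set
  Triple = V H × V H × V H

  -- one simultaneous step of congruent walks P, Q, R from x, y, z along which P avoids Q and R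
  Forward Backward Move : Triple → Triple → Set
  Forward (x , y , z) (x' , y' , z') =
    Arc H x x' × Arc H y y' × Arc H z z' × ¬ Arc H x y' × ¬ Arc H x z'
  Backward (x , y , z) (x' , y' , z') =
    Arc H x' x × Arc H y' y × Arc H z' z × ¬ Arc H y' x × ¬ Arc H z' x
  Move s t = Forward s t ⊎ Backward s t

  -- the walks Q and R have met
  Merged : Triple → Set
  Merged (x , y , z) = y ≡ z

  open Reachability Move Merged

  -- x cannot be selected from (x, y, z) by a conservative majority polymorphism
  Blocked : V H → V H → V H → Set
  Blocked x y z = Reach (x , y , z)

  arc? : ∀ u v → Dec (Arc H u v)
  arc? u v = Digraph.adj H u v Bool.≟ true

  move? : ∀ s t → Dec (Move s t)
  move? (x , y , z) (x' , y' , z') =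
    (arc? x x' ×-dec arc? y y' ×-dec arc? z z' ×-dec ¬? (arc? x y') ×-dec ¬? (arc? x z'))
    ⊎-dec
    (arc? x' x ×-dec arc? y' y ×-dec arc? z' z ×-dec ¬? (arc? y' x) ×-dec ¬? (arc? z' x))

  triples : List Triple
  triples = cartesianProduct vertices (cartesianProduct vertices vertices)
    where vertices = allFin (Digraph.n H)

  ∈-triples : ∀ s → s ∈ triples
  ∈-triples (x , y , z) =
    ∈-cartesianProduct⁺ (∈-allFin x) (∈-cartesianProduct⁺ (∈-allFin y) (∈-allFin z))

  blocked? : ∀ x y z → Dec (Blocked x y z)
  blocked? x y z = reach? (x , y , z)
    where open Decide (≡-dec _≟_ (≡-dec _≟_ _≟_)) triples ∈-triples
                      move? (λ (_ , y , z) → y ≟ z)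

  blocked⇒perm : ∀ {x y z} → Blocked x y z → ∃₂ λ s b → PermCondition H x y z s b
  blocked⇒perm {x} {y} (done refl) = x , y , [] , [] , [] , [] , tt , tt
  blocked⇒perm (next {t = _ , _ , _} (inj₁ (xx' , yy' , zz' , x↛y' , x↛z')) r) =
    let (s , b , ds , P , Q , R , P-Q , P-R) = blocked⇒perm r
    in s , b , forward ∷ ds , fwd xx' P , fwd yy' Q , fwd zz' R , (x↛y' , P-Q) , (x↛z' , P-R)
  blocked⇒perm (next {t = _ , _ , _} (inj₂ (x'x , y'y , z'z , y'↛x , z'↛x)) r) =
    let (s , b , ds , P , Q , R , P-Q , P-R) = blocked⇒perm r
    in s , b , backward ∷ ds , bwd x'x P , bwd y'y Q , bwd z'z R , (y'↛x , P-Q) , (z'↛x , P-R)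

  walks⇒blocked : ∀ {ds x y z s b} (P : Walk H ds x s) (Q : Walk H ds y b) (R : Walk H ds z b) →
                  Avoids H P Q → Avoids H P R → Blocked x y z
  walks⇒blocked [] [] [] _ _ = done refl
  walks⇒blocked (fwd xx' P) (fwd yy' Q) (fwd zz' R) (x↛y' , P-Q) (x↛z' , P-R) =
    next (inj₁ (xx' , yy' , zz' , x↛y' , x↛z')) (walks⇒blocked P Q R P-Q P-R)
  walks⇒blocked (bwd x'x P) (bwd y'y Q) (bwd z'z R) (y'↛x , P-Q) (z'↛x , P-R) =
    next (inj₂ (x'x , y'y , z'z , y'↛x , z'↛x)) (walks⇒blocked P Q R P-Q P-R)

  perm⇒blocked : ∀ {x y z s b} → PermCondition H x y z s b → Blocked x y z
  perm⇒blocked (_ , P , Q , R , P-Q , P-R) = walks⇒blocked P Q R P-Q P-R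

  blocked-swap : ∀ {x y z} → Blocked x y z → Blocked x z y
  blocked-swap = map-Reach (λ (x , y , z) → x , z , y) swap-move sym
    where
    swap-move : ∀ {s t} → Move s t → Move _ _
    swap-move {_ , _ , _} {_ , _ , _} (inj₁ (xx' , yy' , zz' , x↛y' , x↛z')) =
      inj₁ (xx' , zz' , yy' , x↛z' , x↛y')
    swap-move {_ , _ , _} {_ , _ , _} (inj₂ (x'x , y'y , z'z , y'↛x , z'↛x)) =
      inj₂ (x'x , z'z , y'y , z'↛x , y'↛x)

  unblocked-swap : ∀ {x y z} → ¬ Blocked x y z → ¬ Blocked x z y
  unblocked-swap free = free ∘ blocked-swap

  -- A triple repeating its first coordinate cannot move (P cannot avoid an identical Q),
  -- so it is blocked only when it is constant.
  blocked-repeated : ∀ {x z} → Blocked x x z → x ≡ z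
  blocked-repeated (done x≡z) = x≡z
  blocked-repeated (next {t = _ , _ , _} (inj₁ (_ , xy' , _ , x↛y' , _)) _) = contradiction xy' x↛y'
  blocked-repeated (next {t = _ , _ , _} (inj₂ (_ , y'x , _ , y'↛x , _)) _) = contradiction y'x y'↛x

  exchange : ∀ {x y z x' y' z'} → ¬ Blocked x y z → ¬ Blocked y' x' z' →
             Arc H x x' → Arc H y y' → Arc H z z' →
             Arc H x y' ⊎ (¬ Blocked x' y' z' × ¬ Blocked y x z)
  exchange {x} {_} {z} {_} {y'} {z'} x-free y'-free xx' yy' zz' with arc? x y'
  ... | yes xy' = inj₁ xy'
  ... | no x↛y' with arc? x z' | arc? z y'
  ...   | yes xz' | _ = contradiction (next (inj₂ (yy' , xx' , xz' , x↛y' , x↛y')) (done refl)) y'-free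
  ...   | no _ | yes zy' = contradiction (next (inj₁ (xx' , yy' , zy' , x↛y' , x↛y')) (done refl)) x-free
  ...   | no x↛z' | no z↛y' =
    inj₂ ( (λ b → x-free (next (inj₁ (xx' , yy' , zz' , x↛y' , x↛z')) b))
         , (λ b → y'-free (next (inj₂ (yy' , xx' , zz' , x↛y' , z↛y')) b)) )

module Selection (H : Digraph) {g : V H → V H → V H → V H}
                 (poly : IsPolymorphism H g) (cons : IsConservative H g)
                 (maj : ∀ a b → g b a a ≡ a) where
  open TripleGraph H
  open Reachability Move Merged

  blocked-not-selected : ∀ {x y z} → Blocked x y z → g x y z ≡ y ⊎ g x y z ≡ z
  blocked-not-selected {x} {y} (done refl) = inj₁ (maj y x)
  blocked-not-selected {x} {y} {z} (next {t = x' , y' , z'} m r) with cons x y z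
  ... | inj₂ picks-y-or-z = picks-y-or-z
  ... | inj₁ picks-x = ⊥-elim (escape m (blocked-not-selected r))
    where
    -- g follows P from x, but at the next step it sits on Q or R, which P avoids
    escape : Move (x , y , z) (x' , y' , z') → g x' y' z' ≡ y' ⊎ g x' y' z' ≡ z' → ⊥
    escape (inj₁ (xx' , yy' , zz' , x↛y' , x↛z')) = [ x↛y' ∘ out , x↛z' ∘ out ]
      where out : ∀ {w} → g x' y' z' ≡ w → Arc H x w
            out e = subst₂ (Arc H) picks-x e (poly xx' yy' zz')
    escape (inj₂ (x'x , y'y , z'z , y'↛x , z'↛x)) = [ y'↛x ∘ into , z'↛x ∘ into ]
      where into : ∀ {w} → g x' y' z' ≡ w → Arc H w x
            into e = subst₂ (Arc H) e picks-x (poly x'x y'y z'z)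

no-common-choice : ∀ {A : Set} {u v w r : A} → u ≢ v → u ≢ w → v ≢ w →
                   r ≡ v ⊎ r ≡ w → r ≡ u ⊎ r ≡ w → r ≡ u ⊎ r ≡ v → ⊥
no-common-choice u≢v _ _ (inj₁ refl) (inj₁ refl) _ = u≢v refl
no-common-choice _ _ v≢w (inj₁ refl) (inj₂ refl) _ = v≢w refl
no-common-choice _ u≢w _ (inj₂ refl) (inj₁ refl) _ = u≢w refl
no-common-choice _ u≢w _ (inj₂ refl) (inj₂ refl) (inj₁ refl) = u≢w refl
no-common-choice _ _ v≢w (inj₂ refl) (inj₂ refl) (inj₂ refl) = v≢w refl

cmp⇒no-permutable-triple : (H : Digraph) → HasConservativeMajorityPolymorphism H → ¬ PermutableTriple H
cmp⇒no-permutable-triple H (μ , poly , cons , maj) pt =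
  no-common-choice u≢v u≢w v≢w not-u not-v not-w
  where
  open PermutableTriple pt
  open TripleGraph H using (perm⇒blocked)

  not-u : μ u v w ≡ v ⊎ μ u v w ≡ w
  not-u = Selection.blocked-not-selected H poly cons (λ a b → proj₂ (proj₂ (maj a b)))
            (perm⇒blocked cond-u)

  not-v : μ u v w ≡ u ⊎ μ u v w ≡ w
  not-v = Selection.blocked-not-selected H {λ p q r → μ q p r}
            (λ e₁ e₂ e₃ → poly e₂ e₁ e₃)
            (λ a b c → [ inj₂ ∘ inj₁ , [ inj₁ , inj₂ ∘ inj₂ ] ] (cons b a c))
            (λ a b → proj₁ (proj₂ (maj a b)))
            (perm⇒blocked cond-v)

  not-w : μ u v w ≡ u ⊎ μ u v w ≡ v
  not-w = Selection.blocked-not-selected H {λ p q r → μ q r p}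
            (λ e₁ e₂ e₃ → poly e₂ e₃ e₁)
            (λ a b c → [ inj₂ ∘ inj₁ , [ inj₂ ∘ inj₂ , inj₁ ] ] (cons b c a))
            (λ a b → proj₁ (maj a b))
            (perm⇒blocked cond-w)

arc-to-any : ∀ H {u v₁ v₂ v₃ w} → Arc H u v₁ → Arc H u v₂ → Arc H u v₃ →
             w ≡ v₁ ⊎ w ≡ v₂ ⊎ w ≡ v₃ → Arc H u w
arc-to-any _ e₁ _ _ (inj₁ refl) = e₁
arc-to-any _ _ e₂ _ (inj₂ (inj₁ refl)) = e₂
arc-to-any _ _ _ e₃ (inj₂ (inj₂ refl)) = e₃

arc-from-any : ∀ H {u₁ u₂ u₃ v w} → Arc H u₁ v → Arc H u₂ v → Arc H u₃ v →
               w ≡ u₁ ⊎ w ≡ u₂ ⊎ w ≡ u₃ → Arc H w v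
arc-from-any _ e₁ _ _ (inj₁ refl) = e₁
arc-from-any _ _ e₂ _ (inj₂ (inj₁ refl)) = e₂
arc-from-any _ _ _ e₃ (inj₂ (inj₂ refl)) = e₃

-- (⇐): without permutable triples, "select the first unblocked coordinate" is a
-- conservative majority polymorphism.
module FirstUnblocked (H : Digraph) (no-pt : ¬ PermutableTriple H) where
  open TripleGraph H
  open Reachability Move Merged

  assign : (a b p q r : V H) → V H → V H
  assign a b p q r x with x ≟ a | x ≟ b
  ... | yes _ | _ = p
  ... | no _ | yes _ = q
  ... | no _ | no _ = r

  assign-first : ∀ a b p q r → assign a b p q r a ≡ p
  assign-first a b p q r with a ≟ a | a ≟ b
  ... | yes _ | _ = refl
  ... | no a≢a | _ = contradiction refl a≢a

  assign-second : ∀ {a b} p q r → a ≢ b → assign a b p q r b ≡ q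
  assign-second {a} {b} p q r a≢b with b ≟ a | b ≟ b
  ... | yes b≡a | _ = contradiction (sym b≡a) a≢b
  ... | no _ | yes _ = refl
  ... | no _ | no b≢b = contradiction refl b≢b

  assign-other : ∀ {a b c} p q r → a ≢ c → b ≢ c → assign a b p q r c ≡ r
  assign-other {a} {b} {c} p q r a≢c b≢c with c ≟ a | c ≟ b
  ... | yes c≡a | _ = contradiction (sym c≡a) a≢c
  ... | no _ | yes c≡b = contradiction (sym c≡b) b≢c
  ... | no _ | no _ = refl

  permutable : ∀ {a b c} → a ≢ b → a ≢ c → b ≢ c →
               Blocked a b c → Blocked b a c → Blocked c a b → PermutableTriple H
  permutable {a} {b} {c} a≢b a≢c b≢c Ba Bb Bc
    with blocked⇒perm Ba | blocked⇒perm Bb | blocked⇒perm Bc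
  ... | sa , ba , Pa | sb , bb , Pb | sc , bc , Pc = record
    { u = a ; v = b ; w = c ; u≢v = a≢b ; u≢w = a≢c ; v≢w = b≢c
    ; s = assign a b sa sb sc ; b = assign a b ba bb bc
    ; cond-u = subst₂ (PermCondition H a b c) (sym (assign-first a b sa sb sc))
                                              (sym (assign-first a b ba bb bc)) Pa
    ; cond-v = subst₂ (PermCondition H b a c) (sym (assign-second sa sb sc a≢b))
                                              (sym (assign-second ba bb bc a≢b)) Pb
    ; cond-w = subst₂ (PermCondition H c a b) (sym (assign-other sa sb sc a≢c b≢c))
                                              (sym (assign-other ba bb bc a≢c b≢c)) Pc
    }

  all-blocked⇒constant : ∀ {a b c} → Blocked a b c → Blocked b a c → Blocked c a b →
                         a ≡ b × a ≡ c
  all-blocked⇒constant {a} {b} {c} Ba Bb Bc with a ≟ b | a ≟ c | b ≟ c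
  ... | yes refl | _ | _ = refl , blocked-repeated Ba
  ... | no a≢b | yes refl | _ = contradiction (blocked-repeated Bc) a≢b
  ... | no a≢b | no _ | yes refl = contradiction (sym (blocked-repeated (blocked-swap Bb))) a≢b
  ... | no a≢b | no a≢c | no b≢c = ⊥-elim (no-pt (permutable a≢b a≢c b≢c Ba Bb Bc))

  data Choice (a b c : V H) : V H → Set where
    first    : ¬ Blocked a b c → Choice a b c a
    second   : Blocked a b c → ¬ Blocked b a c → Choice a b c b
    third    : Blocked a b c → Blocked b a c → ¬ Blocked c a b → Choice a b c c
    constant : a ≡ b → a ≡ c → Choice a b c a

  choose : ∀ a b c → Σ (V H) (Choice a b c)
  choose a b c with blocked? a b c | blocked? b a c | blocked? c a b
  ... | no a-free | _ | _ = a , first a-free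
  ... | yes Ba | no b-free | _ = b , second Ba b-free
  ... | yes Ba | yes Bb | no c-free = c , third Ba Bb c-free
  ... | yes Ba | yes Bb | yes Bc =
    let (a≡b , a≡c) = all-blocked⇒constant Ba Bb Bc in a , constant a≡b a≡c

  μ : V H → V H → V H → V H
  μ a b c = proj₁ (choose a b c)

  position : ∀ {a b c r} → Choice a b c r → r ≡ a ⊎ r ≡ b ⊎ r ≡ c
  position (first _) = inj₁ refl
  position (second _ _) = inj₂ (inj₁ refl)
  position (third _ _ _) = inj₂ (inj₂ refl)
  position (constant _ _) = inj₁ refl

  -- Arcs are preserved: equal positions are trivial, constant triples reduce to
  -- arc-to-any / arc-from-any, and distinct positions contradict the priority order by
  -- the exchange lemma.
  preserves : ∀ {u₁ u₂ u₃ v₁ v₂ v₃ r r'} → Arc H u₁ v₁ → Arc H u₂ v₂ → Arc H u₃ v₃ →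
              Choice u₁ u₂ u₃ r → Choice v₁ v₂ v₃ r' → Arc H r r'
  preserves e₁ e₂ e₃ (constant refl refl) c' = arc-to-any H e₁ e₂ e₃ (position c')
  preserves e₁ e₂ e₃ c (constant refl refl) = arc-from-any H e₁ e₂ e₃ (position c)
  preserves e₁ _ _ (first _) (first _) = e₁
  preserves _ e₂ _ (second _ _) (second _ _) = e₂
  preserves _ _ e₃ (third _ _ _) (third _ _ _) = e₃
  preserves e₁ e₂ e₃ (first u₁-free) (second Bv₁ v₂-free) =
    fromInj₁ (λ (v₁-free , _) → ⊥-elim (v₁-free Bv₁)) (exchange u₁-free v₂-free e₁ e₂ e₃)
  preserves e₁ e₂ e₃ (first u₁-free) (third Bv₁ _ v₃-free) =
    fromInj₁ (λ (v₁-free , _) → ⊥-elim (unblocked-swap v₁-free Bv₁))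
             (exchange (unblocked-swap u₁-free) v₃-free e₁ e₃ e₂)
  preserves e₁ e₂ e₃ (second Bu₁ u₂-free) (first v₁-free) =
    fromInj₁ (λ (_ , u₁-free) → ⊥-elim (u₁-free Bu₁)) (exchange u₂-free v₁-free e₂ e₁ e₃)
  preserves e₁ e₂ e₃ (second _ u₂-free) (third _ Bv₂ v₃-free) =
    fromInj₁ (λ (v₂-free , _) → ⊥-elim (unblocked-swap v₂-free Bv₂))
             (exchange (unblocked-swap u₂-free) (unblocked-swap v₃-free) e₂ e₃ e₁)
  preserves e₁ e₂ e₃ (third Bu₁ _ u₃-free) (first v₁-free) =
    fromInj₁ (λ (_ , u₁-free) → ⊥-elim (unblocked-swap u₁-free Bu₁))
             (exchange u₃-free (unblocked-swap v₁-free) e₃ e₁ e₂)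
  preserves e₁ e₂ e₃ (third _ Bu₂ u₃-free) (second _ v₂-free) =
    fromInj₁ (λ (_ , u₂-free) → ⊥-elim (unblocked-swap u₂-free Bu₂))
             (exchange (unblocked-swap u₃-free) (unblocked-swap v₂-free) e₃ e₂ e₁)

  -- majority: a repeated value is unblocked at its first occurrence, or the triple is constant
  majority-aab : ∀ {a b r} → Choice a a b r → r ≡ a
  majority-aab (first _) = refl
  majority-aab (second _ _) = refl
  majority-aab (third Ba _ _) = sym (blocked-repeated Ba)
  majority-aab (constant _ _) = refl

  majority-aba : ∀ {a b r} → Choice a b a r → r ≡ a
  majority-aba (first _) = refl
  majority-aba (second Ba _) = sym (blocked-repeated (blocked-swap Ba))
  majority-aba (third _ _ _) = refl
  majority-aba (constant _ _) = refl

  majority-baa : ∀ {a b r} → Choice b a a r → r ≡ a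
  majority-baa (first b-free) = contradiction (done refl) b-free
  majority-baa (second _ _) = refl
  majority-baa (third _ _ _) = refl
  majority-baa (constant b≡a _) = b≡a

  cmp : HasConservativeMajorityPolymorphism H
  cmp = μ
      , (λ {u₁} {_} {u₂} {_} {u₃} e₁ e₂ e₃ →
           preserves e₁ e₂ e₃ (proj₂ (choose u₁ u₂ u₃)) (proj₂ (choose _ _ _)))
      , (λ a b c → position (proj₂ (choose a b c)))
      , (λ a b → majority-aab (proj₂ (choose a a b))
               , majority-aba (proj₂ (choose a b a))
               , majority-baa (proj₂ (choose b a a)))

theorem6 : (H : Digraph) →
    HasConservativeMajorityPolymorphism H ⇔ (¬ PermutableTriple H)
theorem6 H = mk⇔ (cmp⇒no-permutable-triple H) (FirstUnblocked.cmp H)
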